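{- Let $k\ge3$ be odd, and let $N$ be the largest odd number such that $N\le k/3$. Then for every $n\ge1$ and every $n$-ary polymorphism $f\colon\mathbf C_k^n\to\mathbf C_3$, the function $\delta(f)\colon\mathbb Z^n\to\mathbb Z$, $(x_1,\dots,x_n)\mapsto\deg_1f\cdot x_1+\dots+\deg_nf\cdot x_n$, belongs to $\mathcal Z_{\le N}$; i.e., $\sum_{i=1}^n|\deg_if|\le N$ and $\sum_{i=1}^n\deg_if$ is odd.
   Context: $\mathbf C_m$ is the $m$-cycle on $\{0,\dots,m-1\}$, vertices adjacent iff they differ by $1$ mod $m$. $\mathbf C_k^n$ is the direct power (vertex set $V(C_k)^n$, $(\bar u,\bar v)$ an edge iff $(u_j,v_j)\in E(C_k)$ for all $j$); a polymorphism is a graph homomorphism $\mathbf C_k^n\to\mathbf C_3$. $\Delta_{\mathsf E}(\mathbf G)$ is the free Abelian group generated by oriented edges $[u,v]$ of $\mathbf G$ with $[u,v]=-[v,u]$; sets of oriented edges are identified with their sums; a homomorphism $f$ induces $f_{\mathsf E}(\sum c_i[u_i,v_i])=\sum c_i[f(u_i),f(v_i)]$. $O_m=[0,1]+\dots+[m-1,0]\in\Delta_{\mathsf E}(\mathbf C_m)$. $O^n_{k,i}$ is the set of oriented edges $[(a_1,\dots,a_n),(b_1,\dots,b_n)]$ of $\mathbf C_k^n$ with $[a_i,b_i]\in O_k$. $\deg_if$ is the (existing, unique) integer with $f_{\mathsf E}(O^n_{k,i})=(2k)^{n-1}\deg_if\cdot O_3$. For odd $N$, $\mathcal Z_{\le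 N}$ is the set of functions $\mathbb Z^n\to\mathbb Z$ of the form $\sum_ic_ix_i$ with $c_i\in\mathbb Z$, $\sum_i|c_i|\le N$ and $\sum_ic_i$ odd. -}

module Defs where

open import Data.Bool using (Bool; true; false; _∧_; _∨_; if_then_else_; T)
open import Data.Nat as ℕ using (ℕ; zero; suc; _≡ᵇ_)
open import Data.Integer as ℤ using (ℤ; +_; -_)
open import Data.Fin using (Fin; zero; suc; toℕ)
open import Data.Vec using (Vec; []; _∷_; lookup)
open import Data.List using (List; []; _∷_; concatMap; map; foldr)
open import Data.Product using (∃; _×_)
open import Relation.Binary.PropositionalEquality using (_≡_)

allFinL : (m : ℕ) → List (Fin m)
allFinL zero = []
allFinL (suc m) = zero ∷ map suc (allFinL m)

tuples : (n k : ℕ) → List (Vec (Fin k) n)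
tuples zero k = [] ∷ []
tuples (suc n) k = concatMap (λ x → map (x ∷_) (tuples n k)) (allFinL k)

next : (m : ℕ) → Fin m → Fin m → Bool
next m a b = (suc (toℕ a) ≡ᵇ toℕ b) ∨ ((suc (toℕ a) ≡ᵇ m) ∧ (toℕ b ≡ᵇ 0))

adjC : (m : ℕ) → Fin m → Fin m → Bool
adjC m a b = next m a b ∨ next m b a

adjPow : (n k : ℕ) → Vec (Fin k) n → Vec (Fin k) n → Bool
adjPow zero k [] [] = true
adjPow (suc n) k (a ∷ as) (b ∷ bs) = adjC k a b ∧ adjPow n k as bs

IsPolymorphism : (n k : ℕ) → (Vec (Fin k) n → Fin 3) → Set
IsPolymorphism n k f =
  ∀ (u v : Vec (Fin k) n) → T (adjPow n k u v) → T (adjC 3 (f u) (f v))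

-- Δ_E(C_3) is free Abelian on the three oriented edges e_j = [j, j+1 mod 3]
-- (j = 0,1,2), i.e. the edges of O_3; [j+1, j] = - e_j.
ΔE3 : Set
ΔE3 = Fin 3 → ℤ

edgeCoeff : Fin 3 → Fin 3 → Fin 3 → ℤ
edgeCoeff x y j =
  if (toℕ x ≡ᵇ toℕ j) ∧ next 3 x y then + 1
  else if (toℕ y ≡ᵇ toℕ j) ∧ next 3 y x then - (+ 1)
  else + 0

sumℤL : List ℤ → ℤ
sumℤL = foldr ℤ._+_ (+ 0)

-- Membership of the oriented edge [a, b] of C_k^n in O^n_{k,i}:
-- (a, b) is an edge of C_k^n and [a_i, b_i] ∈ O_k, i.e. b_i = a_i + 1 mod k.
inO : (n k : ℕ) → Fin n → Vec (Fin k) n → Vec (Fin k) n → Bool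
inO n k i a b = adjPow n k a b ∧ next k (lookup a i) (lookup b i)

fE-O : (n k : ℕ) → (Vec (Fin k) n → Fin 3) → Fin n → ΔE3
fE-O n k f i j =
  sumℤL (concatMap (λ a → map (λ b →
      if inO n k i a b then edgeCoeff (f a) (f b) j else + 0)
    (tuples n k)) (tuples n k))

O3 : ΔE3
O3 j = + 1

IsDeg : (n k : ℕ) → (Vec (Fin k) n → Fin 3) → Fin n → ℤ → Set
IsDeg n k f i d =
  ∀ (j : Fin 3) → fE-O n k f i j ≡ (+ ((2 ℕ.* k) ℕ.^ (n ℕ.∸ 1))) ℤ.* d ℤ.* O3 j

OddℕP : ℕ → Set
OddℕP m = ∃ λ t → m ≡ suc (2 ℕ.* t)

Oddℤ : ℤ → Set
Oddℤ z = ∃ λ t → z ≡ + 1 ℤ.+ + 2 ℤ.* t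

IsLargestOddBelowThird : ℕ → ℕ → Set
IsLargestOddBelowThird k N =
  OddℕP N × (3 ℕ.* N ℕ.≤ k) × (∀ M → OddℕP M → 3 ℕ.* M ℕ.≤ k → M ℕ.≤ N)

sumℤ : (n : ℕ) → (Fin n → ℤ) → ℤ
sumℤ zero c = + 0
sumℤ (suc n) c = c zero ℤ.+ sumℤ n (λ i → c (suc i))

sumℕ : (n : ℕ) → (Fin n → ℕ) → ℕ
sumℕ zero c = 0
sumℕ (suc n) c = c zero ℕ.+ sumℕ n (λ i → c (suc i))

InZ≤ : (N n : ℕ) → (Fin n → ℤ) → Set
InZ≤ N n c = (sumℕ n (λ i → ℤ.∣ c i ∣) ℕ.≤ N) × Oddℤ (sumℤ n c)

-- For a direction s ∈ {±1}ⁿ let flux s be the total winding, measured in C₃, of f along all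
-- edges a → a + s of Cₖⁿ.  Two paths of length two between the same vertices of C₃ wind
-- equally, so flux is additive in each coordinate; it is also odd under s ↦ −s.  Hence
-- 2·flux s = Σᵢ sᵢ Δᵢ for constants Δᵢ, and counting the edges of O^n_{k,i} gives
-- Δᵢ = 6 k^(n−1) deg_i f.  For sᵢ = sign (deg_i f), k·flux s splits into the windings of the
-- kⁿ closed walks a, a + s, …, a + k s = a.  Each of them is 3q with q odd (the walk has odd
-- length k) and |3q| ≤ k, so |q| ≤ N.  Averaging, kⁿ Σᵢ |deg_i f| = Σₐ qₐ, which forces
-- Σᵢ |deg_i f| ≤ N and Σᵢ |deg_i f| odd, hence Σᵢ deg_i f odd.

module Submission where

open import Defs
open import Data.Bool using (Bool; true; false; not; T; if_then_else_; _∧_)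
open import Data.Bool.Properties using (T-∨; T-∧; T-≡; not-involutive)
open import Data.Empty using (⊥-elim)
open import Data.Fin using (Fin; zero; suc; toℕ; _≟_)
open import Data.Fin.Properties using (toℕ-injective; toℕ-fromℕ<; toℕ<n; all?)
open import Data.Integer as ℤ using (ℤ; +_; -_; _+_; _-_; _*_; ∣_∣; +[1+_]; -[1+_]; +≤+; -≤+)
import Data.Integer.Properties as ℤ
open import Data.Integer.Properties
  using ( +-identityˡ; +-identityʳ; +-assoc; +-comm; +-inverseʳ; *-comm; *-assoc; *-identityˡ; *-identityʳ
        ; *-zeroˡ; *-zeroʳ; *-distribˡ-+; neg-distrib-+; neg-involutive; -1*i≡-i; pos-+; pos-*; abs-*
        ; +∣i∣≡i⊎+∣i∣≡-i; i-j≡0⇒i≡j; *-cancelˡ-≡; *-cancelʳ-≡; drop‿+≤+ )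
open import Data.Integer.Divisibility.Signed
  using (_∣_; _∣?_; divides; quotient; ∣⇒∣ᵤ; ∣m∣n⇒∣m+n; ∣m∣n⇒∣m-n; ∣m⇒∣-m; ∣n⇒∣m*n)
open import Data.Integer.Tactic.RingSolver using (solve-∀)
open import Data.List as List using (List; []; _∷_; concatMap; _++_; length)
open import Data.List.Properties using (length-map; length-++; map-++; map-concatMap)
open import Data.Nat as ℕ using (ℕ; zero; suc; _≤_; s≤s; z≤n; _%_; _/_)
import Data.Nat.Properties as ℕ
import Data.Nat.Divisibility as ℕ
import Data.Nat.Tactic.RingSolver as ℕ-Solver
open import Data.Nat.Properties using (≡ᵇ⇒≡; ≡⇒≡ᵇ)
open import Data.Nat.DivMod
  using (_mod_; m≡m%n+[m/n]*n; %-congˡ; n%n≡0; m%n%n≡m%n; [m+kn]%n≡m%n; m<n⇒m%n≡m; %-distribˡ-+)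
open import Data.Nat.GeneralisedArithmetic using (iterate; iterate-is-fold)
open import Data.Product using (∃; _×_; _,_; proj₁; proj₂)
open import Data.Sum using (_⊎_; inj₁; inj₂)
open import Data.Vec using (Vec; []; _∷_; lookup; map; zipWith; tabulate; replicate; _[_]%=_)
open import Data.Vec.Properties
  using ( lookup-zipWith; lookup-map; lookup-replicate; lookup∘tabulate; lookup∘updateAt; lookup∘updateAt′
        ; updateAt-updateAt; updateAt-id-local )
open import Function using (_∘_; flip; Equivalence; mk⇔)
open import Relation.Nullary using (¬_; yes; no; does)
open import Relation.Nullary.Decidable using (from-yes; _→-dec_; _⊎-dec_; T?)
import Relation.Nullary.Decidable as Dec
open import Relation.Binary.PropositionalEquality

private variable A B : Set

-- Sums over lists

∑ : List A → (A → ℤ) → ℤ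
∑ xs F = sumℤL (List.map F xs)

infixr 7 ∑
syntax ∑ xs (λ x → F) = ∑[ x ∈ xs ] F

∑-cong : (xs : List A) {F G : A → ℤ} → (∀ x → F x ≡ G x) → ∑ xs F ≡ ∑ xs G
∑-cong []       F≗G = refl
∑-cong (x ∷ xs) F≗G = cong₂ _+_ (F≗G x) (∑-cong xs F≗G)

sumℤL-++ : (xs ys : List ℤ) → sumℤL (xs ++ ys) ≡ sumℤL xs + sumℤL ys
sumℤL-++ []       ys = sym (+-identityˡ _)
sumℤL-++ (x ∷ xs) ys = trans (cong (_+_ x) (sumℤL-++ xs ys)) (sym (+-assoc x _ _))

∑-++ : (xs ys : List A) (F : A → ℤ) → ∑ (xs ++ ys) F ≡ ∑ xs F + ∑ ys F
∑-++ xs ys F = trans (cong sumℤL (map-++ F xs ys)) (sumℤL-++ (List.map F xs) (List.map F ys))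

∑-map : (g : B → A) (ys : List B) (F : A → ℤ) → ∑ (List.map g ys) F ≡ ∑[ y ∈ ys ] F (g y)
∑-map g []       F = refl
∑-map g (y ∷ ys) F = cong (_+_ (F (g y))) (∑-map g ys F)

sumℤL-concatMap : (h : A → List ℤ) (xs : List A) → sumℤL (concatMap h xs) ≡ ∑[ x ∈ xs ] sumℤL (h x)
sumℤL-concatMap h []       = refl
sumℤL-concatMap h (x ∷ xs) =
  trans (sumℤL-++ (h x) (concatMap h xs)) (cong (_+_ (sumℤL (h x))) (sumℤL-concatMap h xs))

∑-concatMap : (h : B → List A) (ys : List B) (F : A → ℤ) → ∑ (concatMap h ys) F ≡ ∑[ y ∈ ys ] ∑ (h y) F
∑-concatMap h ys F = trans (cong sumℤL (map-concatMap F h ys)) (sumℤL-concatMap (List.map F ∘ h) ys)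

∑-zero : (xs : List A) → ∑[ x ∈ xs ] + 0 ≡ + 0
∑-zero []       = refl
∑-zero (x ∷ xs) = trans (+-identityˡ _) (∑-zero xs)

∑-distrib-+ : (xs : List A) (F G : A → ℤ) → ∑[ x ∈ xs ] (F x + G x) ≡ ∑ xs F + ∑ xs G
∑-distrib-+ []       F G = refl
∑-distrib-+ (x ∷ xs) F G =
  trans (cong (_+_ (F x + G x)) (∑-distrib-+ xs F G)) (+-interchange (F x) (G x) _ _)
  where
  +-interchange : ∀ a b c d → a + b + (c + d) ≡ a + c + (b + d)
  +-interchange = solve-∀

∑-distrib-+₃ : (xs : List A) (F G H : A → ℤ) →
               ∑ xs F + ∑ xs G + ∑ xs H ≡ ∑[ x ∈ xs ] (F x + G x + H x)
∑-distrib-+₃ xs F G H = trans (cong (_+ ∑ xs H) (sym (∑-distrib-+ xs F G))) (sym (∑-distrib-+ xs _ H))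

∑-distribˡ-* : (xs : List A) (c : ℤ) (F : A → ℤ) → ∑[ x ∈ xs ] (c * F x) ≡ c * ∑ xs F
∑-distribˡ-* []       c F = sym (*-zeroʳ c)
∑-distribˡ-* (x ∷ xs) c F =
  trans (cong (_+_ (c * F x)) (∑-distribˡ-* xs c F)) (sym (*-distribˡ-+ c (F x) _))

∑-distribʳ-* : (xs : List A) (c : ℤ) (F : A → ℤ) → ∑[ x ∈ xs ] (F x * c) ≡ ∑ xs F * c
∑-distribʳ-* xs c F =
  trans (∑-cong xs (λ x → *-comm (F x) c)) (trans (∑-distribˡ-* xs c F) (*-comm c (∑ xs F)))

∑-neg : (xs : List A) (F : A → ℤ) → ∑[ x ∈ xs ] (- F x) ≡ - ∑ xs F
∑-neg []       F = refl
∑-neg (x ∷ xs) F = trans (cong (_+_ (- F x)) (∑-neg xs F)) (sym (neg-distrib-+ (F x) _))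

∑-const : (xs : List A) (c : ℤ) → ∑[ x ∈ xs ] c ≡ + length xs * c
∑-const []       c = refl
∑-const (x ∷ xs) c = trans (cong (_+_ c) (∑-const xs c)) (regroup (+ length xs) c)
  where
  regroup : ∀ m c → c + m * c ≡ (+ 1 + m) * c
  regroup = solve-∀

∑-comm : (xs : List A) (ys : List B) (F : A → B → ℤ) →
         ∑[ x ∈ xs ] ∑[ y ∈ ys ] F x y ≡ ∑[ y ∈ ys ] ∑[ x ∈ xs ] F x y
∑-comm []       ys F = sym (∑-zero ys)
∑-comm (x ∷ xs) ys F =
  trans (cong (_+_ (∑ ys (F x))) (∑-comm xs ys F)) (sym (∑-distrib-+ ys (F x) _))

∑-mono-≤ : (xs : List A) {F G : A → ℤ} → (∀ x → F x ℤ.≤ G x) → ∑ xs F ℤ.≤ ∑ xs G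
∑-mono-≤ []       F≤G = ℤ.≤-refl
∑-mono-≤ (x ∷ xs) F≤G = ℤ.+-mono-≤ (F≤G x) (∑-mono-≤ xs F≤G)

∑-∣ : (xs : List A) {d : ℤ} {F : A → ℤ} → (∀ x → d ∣ F x) → d ∣ ∑ xs F
∑-∣ []       d∣F = divides (+ 0) refl
∑-∣ (x ∷ xs) d∣F = ∣m∣n⇒∣m+n (d∣F x) (∑-∣ xs d∣F)

if-T : ∀ {b} {u v : A} → T b → (if b then u else v) ≡ u
if-T {b = true} _ = refl

if-¬T : ∀ {b} {u v : A} → ¬ T b → (if b then u else v) ≡ v
if-¬T {b = true}  ¬b = ⊥-elim (¬b _)
if-¬T {b = false} ¬b = refl

if-∧ : ∀ b c {v : ℤ} → (if b ∧ c then v else + 0) ≡ (if b then (if c then v else + 0) else + 0)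
if-∧ true  c = refl
if-∧ false c = refl

∑-if : (xs : List A) (b : Bool) (F : A → ℤ) →
       ∑[ x ∈ xs ] (if b then F x else + 0) ≡ (if b then ∑ xs F else + 0)
∑-if xs true  F = refl
∑-if xs false F = ∑-zero xs

length-allFinL : ∀ k → length (allFinL k) ≡ k
length-allFinL zero    = refl
length-allFinL (suc k) = cong suc (trans (length-map suc (allFinL k)) (length-allFinL k))

∑-delta : ∀ k (c : Fin k) (G : Fin k → ℤ) → ∑[ x ∈ allFinL k ] (if does (x ≟ c) then G x else + 0) ≡ G c
∑-delta (suc k) zero    G = trans (cong (_+_ (G zero)) (trans (∑-map suc (allFinL k) _) (∑-zero (allFinL k))))
                                  (+-identityʳ (G zero))
∑-delta (suc k) (suc c) G = trans (+-identityˡ _) (trans (∑-map suc (allFinL k) _) (∑-delta k c (G ∘ suc)))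

∑-bijection : ∀ k (π π⁻¹ : Fin k → Fin k) → (∀ x → π⁻¹ (π x) ≡ x) →
              (∀ y → π (π⁻¹ y) ≡ y) → (H : Fin k → ℤ) → ∑[ x ∈ allFinL k ] H (π x) ≡ ∑ (allFinL k) H
∑-bijection k π π⁻¹ left right H = begin
  ∑[ x ∈ xs ] H (π x)
    ≡⟨ ∑-cong xs (λ x → sym (∑-delta k (π x) H)) ⟩
  ∑[ x ∈ xs ] ∑[ y ∈ xs ] (if does (y ≟ π x) then H y else + 0)
    ≡⟨ ∑-comm xs xs _ ⟩
  ∑[ y ∈ xs ] ∑[ x ∈ xs ] (if does (y ≟ π x) then H y else + 0)
    ≡⟨ ∑-cong xs (λ y → ∑-cong xs (λ x → cong (if_then H y else + 0) (same-test x y))) ⟩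
  ∑[ y ∈ xs ] ∑[ x ∈ xs ] (if does (x ≟ π⁻¹ y) then H y else + 0)
    ≡⟨ ∑-cong xs (λ y → ∑-delta k (π⁻¹ y) (λ _ → H y)) ⟩
  ∑ xs H
    ∎
  where
  open ≡-Reasoning
  xs : List (Fin k)
  xs = allFinL k
  same-test : ∀ x y → does (y ≟ π x) ≡ does (x ≟ π⁻¹ y)
  same-test x y =
    Dec.does-⇔ (mk⇔ (λ { refl → sym (left x) }) (λ { refl → sym (right y) })) (y ≟ π x) (x ≟ π⁻¹ y)

∑-update : ∀ k (c c′ : Fin k → ℤ) i → (∀ j → j ≢ i → c′ j ≡ c j) →
           ∑ (allFinL k) c′ ≡ ∑ (allFinL k) c + (c′ i - c i)
∑-update k c c′ i same = trans (∑-cong (allFinL k) split)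
  (trans (∑-distrib-+ (allFinL k) c _) (cong (_+_ (∑ (allFinL k) c)) (∑-delta k i (λ j → c′ j - c j))))
  where
  split : ∀ j → c′ j ≡ c j + (if does (j ≟ i) then c′ j - c j else + 0)
  split j with j ≟ i
  ... | yes refl = add-difference (c′ j) (c j)
    where
    add-difference : ∀ a b → a ≡ b + (a - b)
    add-difference = solve-∀
  ... | no j≢i = trans (same j j≢i) (sym (+-identityʳ (c j)))

sumℤ≡∑ : ∀ n (c : Fin n → ℤ) → sumℤ n c ≡ ∑ (allFinL n) c
sumℤ≡∑ zero    c = refl
sumℤ≡∑ (suc n) c = cong (_+_ (c zero)) (trans (sumℤ≡∑ n (c ∘ suc)) (sym (∑-map suc (allFinL n) c)))

∑-pos : ∀ n (c : Fin n → ℕ) → ∑[ i ∈ allFinL n ] + c i ≡ + sumℕ n c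
∑-pos zero    c = refl
∑-pos (suc n) c = begin
  + c zero + ∑ (List.map suc (allFinL n)) (+_ ∘ c)
    ≡⟨ cong (_+_ (+ c zero)) (trans (∑-map suc (allFinL n) (+_ ∘ c)) (∑-pos n (c ∘ suc))) ⟩
  + c zero + + sumℕ n (c ∘ suc)
    ≡⟨ pos-+ (c zero) _ ⟨
  + sumℕ (suc n) c
    ∎
  where open ≡-Reasoning

-- Parity

2∤1 : ¬ (+ 2 ∣ + 1)
2∤1 2∣1 with ℕ.∣1⇒≡1 (∣⇒∣ᵤ 2∣1)
... | ()

Oddℤ⇒2∣[i-1] : ∀ {i} → Oddℤ i → + 2 ∣ i - + 1
Oddℤ⇒2∣[i-1] (t , refl) = divides t (cancel t)
  where
  cancel : ∀ t → + 1 + + 2 * t - + 1 ≡ t * + 2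
  cancel = solve-∀

2∣[i-1]⇒Oddℤ : ∀ {i} → + 2 ∣ i - + 1 → Oddℤ i
2∣[i-1]⇒Oddℤ {i} (divides t i-1≡t*2) = t , (begin
  i                ≡⟨ split i ⟩
  + 1 + (i - + 1)  ≡⟨ cong (_+_ (+ 1)) i-1≡t*2 ⟩
  + 1 + t * + 2    ≡⟨ cong (_+_ (+ 1)) (*-comm t (+ 2)) ⟩
  + 1 + + 2 * t    ∎)
  where
  open ≡-Reasoning
  split : ∀ i → i ≡ + 1 + (i - + 1)
  split = solve-∀

OddℕP⇒2∣[n-1] : ∀ {n} → OddℕP n → + 2 ∣ + n - + 1
OddℕP⇒2∣[n-1] (t , refl) = Oddℤ⇒2∣[i-1] (+ t , cong (_+_ (+ 1)) (pos-* 2 t))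

2∣[i-1]⇒OddℕP∣i∣ : ∀ {i} → + 2 ∣ i - + 1 → OddℕP ∣ i ∣
2∣[i-1]⇒OddℕP∣i∣ {i} 2∣i-1 = odd (abs-odd (+∣i∣≡i⊎+∣i∣≡-i i))
  where
  abs-odd : + ∣ i ∣ ≡ i ⊎ + ∣ i ∣ ≡ - i → + 2 ∣ + ∣ i ∣ - + 1
  abs-odd (inj₁ eq) = subst (λ j → + 2 ∣ j - + 1) (sym eq) 2∣i-1
  abs-odd (inj₂ eq) = subst (λ j → + 2 ∣ j - + 1) (sym eq)
    (subst (+ 2 ∣_) (negate (+ 1) i) (∣m∣n⇒∣m+n (∣m⇒∣-m 2∣i-1) (divides (- + 1) refl)))
    where
    negate : ∀ t i → - (i - t) + - t * + 2 ≡ - i - t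
    negate = solve-∀
  odd : ∀ {m} → + 2 ∣ + m - + 1 → OddℕP m
  odd {zero}  2∣-1              = ⊥-elim (2∤1 (∣m⇒∣-m 2∣-1))
  odd {suc m} (divides t m≡t*2) =
    ∣ t ∣ , cong suc (trans (cong ∣_∣ m≡t*2) (trans (abs-* t (+ 2)) (ℕ.*-comm ∣ t ∣ 2)))

2∣i-∣i∣ : ∀ i → + 2 ∣ i - + ∣ i ∣
2∣i-∣i∣ (+ m)    = divides (+ 0) (+-inverseʳ (+ m))
2∣i-∣i∣ -[1+ m ] = divides -[1+ m ] (double -[1+ m ])
  where
  double : ∀ i → i - (- i) ≡ i * + 2
  double = solve-∀

∣[m-1]⇒∣[m^t-1] : ∀ {d} m t → d ∣ + m - + 1 → d ∣ + (m ℕ.^ t) - + 1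
∣[m-1]⇒∣[m^t-1] {d} m zero    _     = divides (+ 0) (sym (*-zeroˡ d))
∣[m-1]⇒∣[m^t-1] {d} m (suc t) d∣m-1 =
  subst (d ∣_) (trans (telescope (+ m) (+ (m ℕ.^ t))) (cong (_- + 1) (sym (pos-* m (m ℕ.^ t)))))
    (∣m∣n⇒∣m+n (∣n⇒∣m*n (+ m) (∣[m-1]⇒∣[m^t-1] m t d∣m-1)) d∣m-1)
  where
  telescope : ∀ m p → m * (p - + 1) + (m - + 1) ≡ m * p - + 1
  telescope = solve-∀

odd-∑∣∣⇒odd-sumℤ : ∀ n (c : Fin n → ℤ) → + 2 ∣ + sumℕ n (∣_∣ ∘ c) - + 1 → Oddℤ (sumℤ n c)
odd-∑∣∣⇒odd-sumℤ n c 2∣∑∣c∣-1 = 2∣[i-1]⇒Oddℤ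
  (subst (+ 2 ∣_) (telescope (sumℤ n c) (+ sumℕ n (∣_∣ ∘ c)))
         (∣m∣n⇒∣m+n 2∣sumℤ-∑∣c∣ 2∣∑∣c∣-1))
  where
  open ≡-Reasoning
  telescope : ∀ s S → s - S + (S - + 1) ≡ s - + 1
  telescope = solve-∀
  2∣sumℤ-∑∣c∣ : + 2 ∣ sumℤ n c - + sumℕ n (∣_∣ ∘ c)
  2∣sumℤ-∑∣c∣ = subst (+ 2 ∣_) (begin
    ∑[ i ∈ allFinL n ] (c i - + ∣ c i ∣)
      ≡⟨ ∑-distrib-+ (allFinL n) c _ ⟩
    ∑ (allFinL n) c + ∑[ i ∈ allFinL n ] (- + ∣ c i ∣)
      ≡⟨ cong (_+_ (∑ (allFinL n) c)) (∑-neg (allFinL n) _) ⟩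
    ∑ (allFinL n) c - ∑[ i ∈ allFinL n ] + ∣ c i ∣
      ≡⟨ cong₂ _-_ (sumℤ≡∑ n c) (sym (∑-pos n (∣_∣ ∘ c))) ⟨
    sumℤ n c - + sumℕ n (∣_∣ ∘ c)
      ∎)
    (∑-∣ (allFinL n) (λ i → 2∣i-∣i∣ (c i)))

odd-average : (xs : List A) (q : A → ℤ) {N S : ℕ} →
              (∀ a → + 2 ∣ q a - + 1) → (∀ a → ∣ q a ∣ ℕ.≤ N) → + 2 ∣ + length xs - + 1 →
              + length xs * + S ≡ ∑ xs q → S ℕ.≤ N × + 2 ∣ + S - + 1
odd-average xs q {N} {S} q-odd ∣q∣≤N m-odd mS≡∑q = S≤N , 2∣S-1
  where
  m : ℕ
  m = length xs
  instance
    m-nonZero : ℕ.NonZero m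
    m-nonZero = ℕ.≢-nonZero λ m≡0 →
      2∤1 (subst (λ i → + 2 ∣ - (i - + 1)) (cong +_ m≡0) (∣m⇒∣-m m-odd))
  S≤N : S ℕ.≤ N
  S≤N = ℕ.*-cancelˡ-≤ m (drop‿+≤+ (begin
    + (m ℕ.* S)      ≡⟨ pos-* m S ⟩
    + m * + S        ≡⟨ mS≡∑q ⟩
    ∑ xs q           ≤⟨ ∑-mono-≤ xs (λ a → ℤ.≤-trans (i≤+∣i∣ (q a)) (+≤+ (∣q∣≤N a))) ⟩
    ∑[ a ∈ xs ] + N  ≡⟨ ∑-const xs (+ N) ⟩
    + m * + N        ≡⟨ pos-* m N ⟨
    + (m ℕ.* N)      ∎))
    where
    open ℤ.≤-Reasoning
    i≤+∣i∣ : ∀ i → i ℤ.≤ + ∣ i ∣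
    i≤+∣i∣ (+ n)    = ℤ.≤-refl
    i≤+∣i∣ -[1+ n ] = -≤+
  2∣∑q-m : + 2 ∣ ∑ xs q - + m
  2∣∑q-m = subst (+ 2 ∣_)
    (trans (∑-distrib-+ xs q (λ _ → - + 1))
           (cong (_+_ (∑ xs q)) (trans (∑-const xs (- + 1)) (times-minus-one (+ m)))))
    (∑-∣ xs q-odd)
    where
    times-minus-one : ∀ i → i * - + 1 ≡ - i
    times-minus-one = solve-∀
  2∣S-1 : + 2 ∣ + S - + 1
  2∣S-1 = subst (+ 2 ∣_) (telescope (+ m) (+ S))
    (∣m∣n⇒∣m-n (subst (λ x → + 2 ∣ x - + m + (+ m - + 1)) (sym mS≡∑q) (∣m∣n⇒∣m+n 2∣∑q-m m-odd))
               (∣n⇒∣m*n (+ S) m-odd))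
    where
    telescope : ∀ m S → m * S - m + (m - + 1) - S * (m - + 1) ≡ S - + 1
    telescope = solve-∀

-- The Boolean cube of directions

signs : (n : ℕ) → List (Vec Bool n)
signs zero    = [] ∷ []
signs (suc n) = List.map (true ∷_) (signs n) ++ List.map (false ∷_) (signs n)

toggle : ∀ {n} → Fin n → Vec Bool n → Vec Bool n
toggle i s = s [ i ]%= not

lookup-toggle : ∀ {n} (i : Fin n) s → lookup (toggle i s) i ≡ not (lookup s i)
lookup-toggle i s = lookup∘updateAt i s

lookup-toggle-other : ∀ {n} (i j : Fin n) s → j ≢ i → lookup (toggle i s) j ≡ lookup s j
lookup-toggle-other i j s j≢i = lookup∘updateAt′ j i j≢i s

toggle-toggle : ∀ {n} (i : Fin n) s → toggle i (toggle i s) ≡ s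
toggle-toggle i s = trans (updateAt-updateAt i s) (updateAt-id-local i s (not-involutive (lookup s i)))

length-signs : ∀ n → length (signs n) ≡ 2 ℕ.^ n
length-signs zero    = refl
length-signs (suc n) = begin
  length (List.map (true ∷_) (signs n) ++ List.map (false ∷_) (signs n))
    ≡⟨ length-++ (List.map (true ∷_) (signs n)) ⟩
  length (List.map (true ∷_) (signs n)) ℕ.+ length (List.map (false ∷_) (signs n))
    ≡⟨ cong₂ ℕ._+_ (trans (length-map _ (signs n)) (length-signs n))
                   (trans (length-map _ (signs n)) (length-signs n)) ⟩
  2 ℕ.^ n ℕ.+ 2 ℕ.^ n
    ≡⟨ cong (2 ℕ.^ n ℕ.+_) (ℕ.+-identityʳ (2 ℕ.^ n)) ⟨
  2 ℕ.^ suc n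
    ∎
  where open ≡-Reasoning

∑-signs-suc : ∀ n (H : Vec Bool (suc n) → ℤ) →
              ∑ (signs (suc n)) H ≡ ∑[ s ∈ signs n ] H (true ∷ s) + ∑[ s ∈ signs n ] H (false ∷ s)
∑-signs-suc n H = trans (∑-++ (List.map (true ∷_) (signs n)) _ H)
                        (cong₂ _+_ (∑-map (true ∷_) (signs n) H) (∑-map (false ∷_) (signs n) H))

∑-toggle : ∀ n (i : Fin n) (H : Vec Bool n → ℤ) → ∑[ s ∈ signs n ] H (toggle i s) ≡ ∑ (signs n) H
∑-toggle (suc n) zero H = begin
  ∑[ s ∈ signs (suc n) ] H (toggle zero s)
    ≡⟨ ∑-signs-suc n _ ⟩
  ∑[ s ∈ signs n ] H (false ∷ s) + ∑[ s ∈ signs n ] H (true ∷ s)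
    ≡⟨ +-comm (∑[ s ∈ signs n ] H (false ∷ s)) _ ⟩
  ∑[ s ∈ signs n ] H (true ∷ s) + ∑[ s ∈ signs n ] H (false ∷ s)
    ≡⟨ ∑-signs-suc n H ⟨
  ∑ (signs (suc n)) H
    ∎
  where open ≡-Reasoning
∑-toggle (suc n) (suc i) H = begin
  ∑[ s ∈ signs (suc n) ] H (toggle (suc i) s)
    ≡⟨ ∑-signs-suc n _ ⟩
  ∑[ s ∈ signs n ] H (true ∷ toggle i s) + ∑[ s ∈ signs n ] H (false ∷ toggle i s)
    ≡⟨ cong₂ _+_ (∑-toggle n i _) (∑-toggle n i _) ⟩
  ∑[ s ∈ signs n ] H (true ∷ s) + ∑[ s ∈ signs n ] H (false ∷ s)
    ≡⟨ ∑-signs-suc n H ⟨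
  ∑ (signs (suc n)) H
    ∎
  where open ≡-Reasoning

∑-negate : ∀ n (H : Vec Bool n → ℤ) → ∑[ s ∈ signs n ] H (map not s) ≡ ∑ (signs n) H
∑-negate zero    H = refl
∑-negate (suc n) H = begin
  ∑[ s ∈ signs (suc n) ] H (map not s)
    ≡⟨ ∑-signs-suc n _ ⟩
  ∑[ s ∈ signs n ] H (false ∷ map not s) + ∑[ s ∈ signs n ] H (true ∷ map not s)
    ≡⟨ +-comm (∑[ s ∈ signs n ] H (false ∷ map not s)) _ ⟩
  ∑[ s ∈ signs n ] H (true ∷ map not s) + ∑[ s ∈ signs n ] H (false ∷ map not s)
    ≡⟨ cong₂ _+_ (∑-negate n _) (∑-negate n _) ⟩
  ∑[ s ∈ signs n ] H (true ∷ s) + ∑[ s ∈ signs n ] H (false ∷ s)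
    ≡⟨ ∑-signs-suc n H ⟨
  ∑ (signs (suc n)) H
    ∎
  where open ≡-Reasoning

∑-split : ∀ n (i : Fin n) (H : Vec Bool n → ℤ) →
          ∑ (signs n) H ≡ ∑[ s ∈ signs n ] (if lookup s i then H s else + 0)
                        + ∑[ s ∈ signs n ] (if lookup s i then H (toggle i s) else + 0)
∑-split n i H = begin
  ∑ (signs n) H
    ≡⟨ ∑-cong (signs n) (λ s → by-value (lookup s i)) ⟩
  ∑[ s ∈ signs n ] ((if lookup s i then H s else + 0) + (if not (lookup s i) then H s else + 0))
    ≡⟨ ∑-distrib-+ (signs n) _ _ ⟩
  upper + ∑[ s ∈ signs n ] (if not (lookup s i) then H s else + 0)
    ≡⟨ cong (_+_ upper) (∑-toggle n i _) ⟨
  upper + ∑[ s ∈ signs n ] (if not (lookup (toggle i s) i) then H (toggle i s) else + 0)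
    ≡⟨ cong (_+_ upper) (∑-cong (signs n) λ s → cong (if_then H (toggle i s) else + 0)
                           (trans (cong not (lookup-toggle i s)) (not-involutive (lookup s i)))) ⟩
  upper + ∑[ s ∈ signs n ] (if lookup s i then H (toggle i s) else + 0)
    ∎
  where
  open ≡-Reasoning
  upper : ℤ
  upper = ∑[ s ∈ signs n ] (if lookup s i then H s else + 0)
  by-value : ∀ b {v} → v ≡ (if b then v else + 0) + (if not b then v else + 0)
  by-value true  = sym (+-identityʳ _)
  by-value false = sym (+-identityˡ _)

toggle-invariant⇒constant : ∀ {n} (Q : Vec Bool n → ℤ) → (∀ i s → Q (toggle i s) ≡ Q s) →
                            ∀ s r → Q s ≡ Q r
toggle-invariant⇒constant Q invariant []      []      = refl
toggle-invariant⇒constant Q invariant (b ∷ s) (c ∷ r) =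
  trans (same-tail b c) (toggle-invariant⇒constant (Q ∘ (c ∷_)) (λ i → invariant (suc i) ∘ (c ∷_)) s r)
  where
  same-tail : ∀ b c → Q (b ∷ s) ≡ Q (c ∷ s)
  same-tail true  true  = refl
  same-tail false false = refl
  same-tail true  false = invariant zero (false ∷ s)
  same-tail false true  = invariant zero (true ∷ s)

-- The cycle C_K and its direct powers

module Cycle (K : ℕ) .{{_ : ℕ.NonZero K}} where

  rot : ℕ → Fin K → Fin K
  rot c x = (c ℕ.+ toℕ x) mod K

  toℕ-rot : ∀ c x → toℕ (rot c x) ≡ (c ℕ.+ toℕ x) % K
  toℕ-rot c x = toℕ-fromℕ< _

  private
    [m+n%K]%K≡[m+n]%K : ∀ m n → (m ℕ.+ n % K) % K ≡ (m ℕ.+ n) % K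
    [m+n%K]%K≡[m+n]%K m n = begin
      (m ℕ.+ n % K) % K          ≡⟨ %-distribˡ-+ m (n % K) K ⟩
      (m % K ℕ.+ n % K % K) % K  ≡⟨ cong (λ r → (m % K ℕ.+ r) % K) (m%n%n≡m%n n K) ⟩
      (m % K ℕ.+ n % K) % K      ≡⟨ %-distribˡ-+ m n K ⟨
      (m ℕ.+ n) % K              ∎
      where open ≡-Reasoning

    toℕ%K : ∀ (x : Fin K) → toℕ x % K ≡ toℕ x
    toℕ%K x = m<n⇒m%n≡m (toℕ<n x)

  rot-rot : ∀ c d x → rot d (rot c x) ≡ rot (c ℕ.+ d) x
  rot-rot c d x = toℕ-injective (begin
    toℕ (rot d (rot c x))          ≡⟨ toℕ-rot d (rot c x) ⟩
    (d ℕ.+ toℕ (rot c x)) % K      ≡⟨ cong (λ r → (d ℕ.+ r) % K) (toℕ-rot c x) ⟩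
    (d ℕ.+ (c ℕ.+ toℕ x) % K) % K  ≡⟨ [m+n%K]%K≡[m+n]%K d (c ℕ.+ toℕ x) ⟩
    (d ℕ.+ (c ℕ.+ toℕ x)) % K      ≡⟨ cong (_% K) (reorder c d (toℕ x)) ⟩
    (c ℕ.+ d ℕ.+ toℕ x) % K        ≡⟨ toℕ-rot (c ℕ.+ d) x ⟨
    toℕ (rot (c ℕ.+ d) x)          ∎)
    where
    open ≡-Reasoning
    reorder : ∀ c d x → d ℕ.+ (c ℕ.+ x) ≡ c ℕ.+ d ℕ.+ x
    reorder = ℕ-Solver.solve-∀

  rot-multiple : ∀ t x → rot (t ℕ.* K) x ≡ x
  rot-multiple t x = toℕ-injective (begin
    toℕ (rot (t ℕ.* K) x)    ≡⟨ toℕ-rot (t ℕ.* K) x ⟩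
    (t ℕ.* K ℕ.+ toℕ x) % K  ≡⟨ cong (_% K) (ℕ.+-comm (t ℕ.* K) (toℕ x)) ⟩
    (toℕ x ℕ.+ t ℕ.* K) % K  ≡⟨ [m+kn]%n≡m%n (toℕ x) t K ⟩
    toℕ x % K                ≡⟨ toℕ%K x ⟩
    toℕ x                    ∎)
    where open ≡-Reasoning

  rot-K : ∀ x → rot K x ≡ x
  rot-K x = trans (cong (λ c → rot c x) (sym (ℕ.*-identityˡ K))) (rot-multiple 1 x)

  iterate-rot : ∀ c t x → iterate (rot c) x t ≡ rot (t ℕ.* c) x
  iterate-rot c zero    x = sym (toℕ-injective (trans (toℕ-rot 0 x) (toℕ%K x)))
  iterate-rot c (suc t) x = trans (iterate-rot c t (rot c x)) (rot-rot c (t ℕ.* c) x)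

  toℕ-rot1 : ∀ x → suc (toℕ x) ℕ.< K → toℕ (rot 1 x) ≡ suc (toℕ x)
  toℕ-rot1 x x+1<K = trans (toℕ-rot 1 x) (m<n⇒m%n≡m x+1<K)

  toℕ-rot1-last : ∀ x → suc (toℕ x) ≡ K → toℕ (rot 1 x) ≡ 0
  toℕ-rot1-last x x+1≡K = trans (toℕ-rot 1 x) (trans (%-congˡ x+1≡K) (n%n≡0 K))

  next⇒≡rot1 : ∀ {x y} → T (next K x y) → y ≡ rot 1 x
  next⇒≡rot1 {x} {y} xy with Equivalence.to T-∨ xy
  ... | inj₁ x+1≡ᵇy = toℕ-injective (begin
    toℕ y          ≡⟨ x+1≡y ⟨
    suc (toℕ x)    ≡⟨ toℕ-rot1 x (subst (ℕ._< K) (sym x+1≡y) (toℕ<n y)) ⟨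
    toℕ (rot 1 x)  ∎)
    where
    open ≡-Reasoning
    x+1≡y : suc (toℕ x) ≡ toℕ y
    x+1≡y = ≡ᵇ⇒≡ (suc (toℕ x)) (toℕ y) x+1≡ᵇy
  ... | inj₂ wrap with Equivalence.to T-∧ wrap
  ...   | x+1≡ᵇK , y≡ᵇ0 = toℕ-injective
    (trans (≡ᵇ⇒≡ (toℕ y) 0 y≡ᵇ0) (sym (toℕ-rot1-last x (≡ᵇ⇒≡ (suc (toℕ x)) K x+1≡ᵇK))))

  next-rot1 : ∀ x → T (next K x (rot 1 x))
  next-rot1 x with ℕ.m≤n⇒m<n∨m≡n (toℕ<n x)
  ... | inj₁ x+1<K = Equivalence.from T-∨ (inj₁ (≡⇒≡ᵇ _ _ (sym (toℕ-rot1 x x+1<K))))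
  ... | inj₂ x+1≡K = Equivalence.from T-∨ (inj₂ (Equivalence.from T-∧
                       (≡⇒≡ᵇ _ _ x+1≡K , ≡⇒≡ᵇ _ _ (toℕ-rot1-last x x+1≡K))))

  offset : Bool → ℕ
  offset true  = 1
  offset false = ℕ.pred K

  step : Bool → Fin K → Fin K
  step b = rot (offset b)

  offset-not : ∀ b → offset b ℕ.+ offset (not b) ≡ K
  offset-not true  = ℕ.suc-pred K
  offset-not false = trans (ℕ.+-comm (ℕ.pred K) 1) (ℕ.suc-pred K)

  step-not : ∀ b x → step (not b) (step b x) ≡ x
  step-not b x = trans (rot-rot (offset b) (offset (not b)) x)
                       (trans (cong (λ c → rot c x) (offset-not b)) (rot-K x))

  step-not⁻¹ : ∀ b x → step b (step (not b) x) ≡ x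
  step-not⁻¹ true  = step-not false
  step-not⁻¹ false = step-not true

  adjC-step : ∀ b x → T (adjC K x (step b x))
  adjC-step true  x = Equivalence.from T-∨ (inj₁ (next-rot1 x))
  adjC-step false x = Equivalence.from (T-∨ {next K x (step false x)}) (inj₂
    (subst (T ∘ next K (step false x)) (step-not false x) (next-rot1 (step false x))))

  adjC⇒step : ∀ {x y} → T (adjC K x y) → ∃ λ b → y ≡ step b x
  adjC⇒step {x} {y} xy with Equivalence.to T-∨ xy
  ... | inj₁ x→y = true , next⇒≡rot1 x→y
  ... | inj₂ y→x = false , trans (sym (step-not true y)) (cong (step false) (sym (next⇒≡rot1 y→x)))

  infixl 6 _⊕_
  _⊕_ : ∀ {n} → Vec (Fin K) n → Vec Bool n → Vec (Fin K) n
  a ⊕ s = zipWith (flip step) a s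

  lookup-⊕ : ∀ {n} (a : Vec (Fin K) n) s i → lookup (a ⊕ s) i ≡ step (lookup s i) (lookup a i)
  lookup-⊕ a s i = lookup-zipWith (flip step) i a s

  adjPow-⊕ : ∀ {n} (a : Vec (Fin K) n) s → T (adjPow n K a (a ⊕ s))
  adjPow-⊕ []      []      = _
  adjPow-⊕ (x ∷ a) (b ∷ s) = Equivalence.from T-∧ (adjC-step b x , adjPow-⊕ a s)

  ⊕-negate : ∀ {n} (a : Vec (Fin K) n) s → a ⊕ s ⊕ map not s ≡ a
  ⊕-negate []      []      = refl
  ⊕-negate (x ∷ a) (b ∷ s) = cong₂ _∷_ (step-not b x) (⊕-negate a s)

  ⊕-toggle-exchange : ∀ {n} (a : Vec (Fin K) n) s r j → lookup s j ≡ lookup r j →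
                      a ⊕ s ⊕ toggle j r ≡ a ⊕ toggle j s ⊕ r
  ⊕-toggle-exchange (x ∷ a) (b ∷ s) (.b ∷ r) zero    refl =
    cong (_∷ a ⊕ s ⊕ r) (trans (step-not b x) (sym (step-not⁻¹ b x)))
  ⊕-toggle-exchange (x ∷ a) (b ∷ s) (c ∷ r)  (suc j) sⱼ≡rⱼ =
    cong (step c (step b x) ∷_) (⊕-toggle-exchange a s r j sⱼ≡rⱼ)

  iterate-⊕-∷ : ∀ {n} b (s : Vec Bool n) x a t →
                iterate (_⊕ (b ∷ s)) (x ∷ a) t ≡ iterate (step b) x t ∷ iterate (_⊕ s) a t
  iterate-⊕-∷ b s x a zero    = refl
  iterate-⊕-∷ b s x a (suc t) = iterate-⊕-∷ b s (step b x) (a ⊕ s) t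

  iterate-⊕-K : ∀ {n} (s : Vec Bool n) a → iterate (_⊕ s) a K ≡ a
  iterate-⊕-K [] [] with iterate (_⊕ []) [] K
  ... | [] = refl
  iterate-⊕-K (b ∷ s) (x ∷ a) = trans (iterate-⊕-∷ b s x a K) (cong₂ _∷_ step-K (iterate-⊕-K s a))
    where
    step-K : iterate (step b) x K ≡ x
    step-K = trans (iterate-rot (offset b) K x)
                   (trans (cong (λ c → rot c x) (ℕ.*-comm K (offset b))) (rot-multiple (offset b) x))

  ∑-tuples-suc : ∀ n (H : Vec (Fin K) (suc n) → ℤ) →
                 ∑ (tuples (suc n) K) H ≡ ∑[ x ∈ allFinL K ] ∑[ a ∈ tuples n K ] H (x ∷ a)
  ∑-tuples-suc n H = trans (∑-concatMap _ (allFinL K) H)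
                           (∑-cong (allFinL K) (λ x → ∑-map (x ∷_) (tuples n K) H))

  ∑-tuples-const : ∀ n (c : ℤ) → ∑[ a ∈ tuples n K ] c ≡ + (K ℕ.^ n) * c
  ∑-tuples-const zero    c = trans (+-identityʳ c) (sym (*-identityˡ c))
  ∑-tuples-const (suc n) c = begin
    ∑[ a ∈ tuples (suc n) K ] c               ≡⟨ ∑-tuples-suc n (λ _ → c) ⟩
    ∑[ x ∈ allFinL K ] ∑[ a ∈ tuples n K ] c  ≡⟨ ∑-cong (allFinL K) (λ _ → ∑-tuples-const n c) ⟩
    ∑[ x ∈ allFinL K ] (+ (K ℕ.^ n) * c)      ≡⟨ ∑-const (allFinL K) _ ⟩
    + length (allFinL K) * (+ (K ℕ.^ n) * c)  ≡⟨ cong (λ l → + l * (+ (K ℕ.^ n) * c)) (length-allFinL K) ⟩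
    + K * (+ (K ℕ.^ n) * c)                   ≡⟨ *-assoc (+ K) _ c ⟨
    + K * + (K ℕ.^ n) * c                     ≡⟨ cong (_* c) (pos-* K (K ℕ.^ n)) ⟨
    + (K ℕ.^ suc n) * c                       ∎
    where open ≡-Reasoning

  length-tuples : ∀ n → length (tuples n K) ≡ K ℕ.^ n
  length-tuples n = ℤ.+-injective (begin
    + length (tuples n K)        ≡⟨ *-identityʳ _ ⟨
    + length (tuples n K) * + 1  ≡⟨ ∑-const (tuples n K) (+ 1) ⟨
    ∑[ a ∈ tuples n K ] + 1      ≡⟨ ∑-tuples-const n (+ 1) ⟩
    + (K ℕ.^ n) * + 1            ≡⟨ *-identityʳ _ ⟩
    + (K ℕ.^ n)                  ∎)
    where open ≡-Reasoning

  ∑-⊕ : ∀ n (s : Vec Bool n) (H : Vec (Fin K) n → ℤ) →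
        ∑[ a ∈ tuples n K ] H (a ⊕ s) ≡ ∑ (tuples n K) H
  ∑-⊕ zero    []      H = refl
  ∑-⊕ (suc n) (b ∷ s) H = begin
    ∑[ a ∈ tuples (suc n) K ] H (a ⊕ (b ∷ s))
      ≡⟨ ∑-tuples-suc n _ ⟩
    ∑[ x ∈ allFinL K ] ∑[ a ∈ tuples n K ] H (step b x ∷ a ⊕ s)
      ≡⟨ ∑-cong (allFinL K) (λ x → ∑-⊕ n s (H ∘ (step b x ∷_))) ⟩
    ∑[ x ∈ allFinL K ] ∑[ a ∈ tuples n K ] H (step b x ∷ a)
      ≡⟨ ∑-bijection K (step b) (step (not b)) (step-not b) (step-not⁻¹ b) _ ⟩
    ∑[ x ∈ allFinL K ] ∑[ a ∈ tuples n K ] H (x ∷ a)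
      ≡⟨ ∑-tuples-suc n H ⟨
    ∑ (tuples (suc n) K) H
      ∎
    where open ≡-Reasoning

  module _ (3≤K : 3 ≤ K) where

    rot2≢id : ∀ x → rot 2 x ≢ x
    rot2≢id x rot2x≡x = ℕ.<⇒≱ 3≤K (ℕ.∣⇒≤ (ℕ.divides q 2≡q*K))
      where
      open ≡-Reasoning
      q : ℕ
      q = (2 ℕ.+ toℕ x) / K
      2≡q*K : 2 ≡ q ℕ.* K
      2≡q*K = ℕ.+-cancelˡ-≡ (toℕ x) _ _ (begin
        toℕ x ℕ.+ 2                    ≡⟨ ℕ.+-comm (toℕ x) 2 ⟩
        2 ℕ.+ toℕ x                    ≡⟨ m≡m%n+[m/n]*n (2 ℕ.+ toℕ x) K ⟩
        (2 ℕ.+ toℕ x) % K ℕ.+ q ℕ.* K  ≡⟨ cong (ℕ._+ q ℕ.* K) (trans (sym (toℕ-rot 2 x)) (cong toℕ rot2x≡x)) ⟩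
        toℕ x ℕ.+ q ℕ.* K              ∎)

    step-true≢step-false : ∀ x → step true x ≢ step false x
    step-true≢step-false x x+1≡x-1 = rot2≢id x (begin
      rot 2 x               ≡⟨ rot-rot 1 1 x ⟨
      rot 1 (step true x)   ≡⟨ cong (rot 1) x+1≡x-1 ⟩
      rot 1 (step false x)  ≡⟨ step-not false x ⟩
      x                     ∎)
      where open ≡-Reasoning

    next-step : ∀ b x → next K x (step b x) ≡ b
    next-step true  x = Equivalence.to T-≡ (next-rot1 x)
    next-step false x with next K x (step false x) in x→x-1
    ... | false = refl
    ... | true  = ⊥-elim (step-true≢step-false x (sym (next⇒≡rot1 (subst T (sym x→x-1) _))))

    adjC-split : ∀ x y (v : ℤ) →
      (if adjC K x y then v else + 0) ≡
      (if does (y ≟ step true x) then v else + 0) + (if does (y ≟ step false x) then v else + 0)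
    adjC-split x y v with y ≟ step true x | y ≟ step false x
    ... | yes refl | yes x+1≡x-1 = ⊥-elim (step-true≢step-false x x+1≡x-1)
    ... | yes refl | no _        = trans (if-T (adjC-step true x)) (sym (+-identityʳ v))
    ... | no _     | yes refl    = trans (if-T (adjC-step false x)) (sym (+-identityˡ v))
    ... | no y≢x+1 | no y≢x-1    = if-¬T not-adjacent
      where
      not-adjacent : ¬ T (adjC K x y)
      not-adjacent xy with adjC⇒step xy
      ... | true  , y≡x+1 = y≢x+1 y≡x+1
      ... | false , y≡x-1 = y≢x-1 y≡x-1

    ∑-adjC : ∀ x (Q : Fin K → ℤ) →
             ∑[ y ∈ allFinL K ] (if adjC K x y then Q y else + 0) ≡ Q (step true x) + Q (step false x)
    ∑-adjC x Q = trans (∑-cong (allFinL K) (λ y → adjC-split x y (Q y)))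
      (trans (∑-distrib-+ (allFinL K) _ _) (cong₂ _+_ (∑-delta K (step true x) Q) (∑-delta K (step false x) Q)))

    ∑-adjPow : ∀ n (a : Vec (Fin K) n) (H : Vec (Fin K) n → ℤ) →
               ∑[ b ∈ tuples n K ] (if adjPow n K a b then H b else + 0) ≡ ∑[ s ∈ signs n ] H (a ⊕ s)
    ∑-adjPow zero    []      H = refl
    ∑-adjPow (suc n) (x ∷ a) H = begin
      ∑[ b ∈ tuples (suc n) K ] (if adjPow (suc n) K (x ∷ a) b then H b else + 0)
        ≡⟨ ∑-tuples-suc n _ ⟩
      ∑[ y ∈ allFinL K ] ∑[ b ∈ tuples n K ] (if adjC K x y ∧ adjPow n K a b then H (y ∷ b) else + 0)
        ≡⟨ ∑-cong (allFinL K) (λ y → trans (∑-cong (tuples n K) (λ b → if-∧ (adjC K x y) _))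
                                           (∑-if (tuples n K) (adjC K x y) _)) ⟩
      ∑[ y ∈ allFinL K ]
        (if adjC K x y then ∑[ b ∈ tuples n K ] (if adjPow n K a b then H (y ∷ b) else + 0) else + 0)
        ≡⟨ ∑-cong (allFinL K) (λ y → cong (if adjC K x y then_else + 0) (∑-adjPow n a (H ∘ (y ∷_)))) ⟩
      ∑[ y ∈ allFinL K ] (if adjC K x y then ∑[ s ∈ signs n ] H (y ∷ a ⊕ s) else + 0)
        ≡⟨ ∑-adjC x (λ y → ∑[ s ∈ signs n ] H (y ∷ a ⊕ s)) ⟩
      ∑[ s ∈ signs n ] H (step true x ∷ a ⊕ s) + ∑[ s ∈ signs n ] H (step false x ∷ a ⊕ s)
        ≡⟨ ∑-signs-suc n (λ s → H ((x ∷ a) ⊕ s)) ⟨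
      ∑[ s ∈ signs (suc n) ] H ((x ∷ a) ⊕ s)
        ∎
      where open ≡-Reasoning

-- Winding in C₃

-- The sum of the coordinates of the oriented edge [x, y] in Δ_E(C₃): +1 along O₃, −1 against
-- it, 0 if x and y are not adjacent.
turn : Fin 3 → Fin 3 → ℤ
turn x y = edgeCoeff x y zero + edgeCoeff x y (suc zero) + edgeCoeff x y (suc (suc zero))

turn-antisym : ∀ x y → turn y x ≡ - turn x y
turn-antisym = from-yes (all? λ x → all? λ y → turn y x ℤ.≟ - turn x y)

turn-±1 : ∀ x y → T (adjC 3 x y) → turn x y ≡ + 1 ⊎ turn x y ≡ - + 1
turn-±1 = from-yes (all? λ x → all? λ y →
  T? (adjC 3 x y) →-dec (turn x y ℤ.≟ + 1 ⊎-dec turn x y ℤ.≟ - + 1))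

turn-potential : ∀ x y → + 3 ∣ turn x y + + toℕ x - + toℕ y
turn-potential = from-yes (all? λ x → all? λ y → + 3 ∣? turn x y + + toℕ x - + toℕ y)

turn-square : ∀ x y z w → T (adjC 3 x y) → T (adjC 3 y z) → T (adjC 3 x w) → T (adjC 3 w z) →
              turn x y + turn y z ≡ turn x w + turn w z
turn-square = from-yes (all? λ x → all? λ y → all? λ z → all? λ w →
  T? (adjC 3 x y) →-dec (T? (adjC 3 y z) →-dec (T? (adjC 3 x w) →-dec (T? (adjC 3 w z) →-dec
  (turn x y + turn y z ℤ.≟ turn x w + turn w z)))))

turns : ℕ → (ℕ → Fin 3) → ℤ
turns zero    p = + 0
turns (suc L) p = turn (p 0) (p 1) + turns L (p ∘ suc)

IsWalk : (ℕ → Fin 3) → Set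
IsWalk p = ∀ t → T (adjC 3 (p t) (p (suc t)))

turns-potential : ∀ L p → + 3 ∣ turns L p + + toℕ (p 0) - + toℕ (p L)
turns-potential zero    p = divides (+ 0) (cancel (+ toℕ (p 0)))
  where
  cancel : ∀ a → + 0 + a - a ≡ + 0 * + 3
  cancel = solve-∀
turns-potential (suc L) p =
  subst (+ 3 ∣_) (telescope (turn (p 0) (p 1)) (turns L (p ∘ suc)) (+ toℕ (p 0)) (+ toℕ (p 1)) _)
    (∣m∣n⇒∣m+n (turn-potential (p 0) (p 1)) (turns-potential L (p ∘ suc)))
  where
  telescope : ∀ t ts a b c → (t + a - b) + (ts + b - c) ≡ t + ts + a - c
  telescope = solve-∀

turns-parity : ∀ L p → IsWalk p → + 2 ∣ turns L p - + L
turns-parity zero    p walk = divides (+ 0) refl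
turns-parity (suc L) p walk =
  subst (+ 2 ∣_) (regroup (turn (p 0) (p 1)) (turns L (p ∘ suc)) (+ L))
    (∣m∣n⇒∣m+n (2∣±1-1 (turn-±1 (p 0) (p 1) (walk 0))) (turns-parity L (p ∘ suc) (walk ∘ suc)))
  where
  regroup : ∀ t ts l → (t - + 1) + (ts - l) ≡ t + ts - (+ 1 + l)
  regroup = solve-∀
  2∣±1-1 : ∀ {t} → t ≡ + 1 ⊎ t ≡ - + 1 → + 2 ∣ t - + 1
  2∣±1-1 (inj₁ refl) = divides (+ 0) refl
  2∣±1-1 (inj₂ refl) = divides (- + 1) refl

turns-bound : ∀ L p → IsWalk p → ∣ turns L p ∣ ℕ.≤ L
turns-bound zero    p walk = z≤n
turns-bound (suc L) p walk = ℕ.≤-trans (ℤ.∣i+j∣≤∣i∣+∣j∣ (turn (p 0) (p 1)) _)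
  (ℕ.+-mono-≤ (ℕ.≤-reflexive (∣±1∣≡1 (turn-±1 (p 0) (p 1) (walk 0))))
              (turns-bound L (p ∘ suc) (walk ∘ suc)))
  where
  ∣±1∣≡1 : ∀ {t} → t ≡ + 1 ⊎ t ≡ - + 1 → ∣ t ∣ ≡ 1
  ∣±1∣≡1 (inj₁ refl) = refl
  ∣±1∣≡1 (inj₂ refl) = refl

closed-walk : ∀ {L N} p → IsWalk p → p L ≡ p 0 → OddℕP L → IsLargestOddBelowThird L N →
              ∃ λ q → turns L p ≡ q * + 3 × + 2 ∣ q - + 1 × ∣ q ∣ ℕ.≤ N
closed-walk {L} {N} p walk closed (j , L≡1+2j) (_ , _ , N-largest) = q , turns≡q*3 , 2∣q-1 , ∣q∣≤N
  where
  3∣turns : + 3 ∣ turns L p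
  3∣turns = subst (+ 3 ∣_) (cancel (turns L p) (+ toℕ (p 0)))
    (subst (λ y → + 3 ∣ turns L p + + toℕ (p 0) - + toℕ y) closed (turns-potential L p))
    where
    cancel : ∀ t a → t + a - a ≡ t
    cancel = solve-∀
  q : ℤ
  q = quotient 3∣turns
  turns≡q*3 : turns L p ≡ q * + 3
  turns≡q*3 = _∣_.equality 3∣turns
  2∣q-1 : + 2 ∣ q - + 1
  2∣q-1 = subst (+ 2 ∣_) (regroup q (+ j))
    (∣m∣n⇒∣m+n (subst₂ (λ t l → + 2 ∣ t - l) turns≡q*3 L≡1+2j′ (turns-parity L p walk))
               (divides (+ j - q) refl))
    where
    L≡1+2j′ : + L ≡ + 1 + + 2 * + j
    L≡1+2j′ = trans (cong +_ L≡1+2j) (cong (_+_ (+ 1)) (pos-* 2 j))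
    regroup : ∀ q j → q * + 3 - (+ 1 + + 2 * j) + (j - q) * + 2 ≡ q - + 1
    regroup = solve-∀
  ∣q∣≤N : ∣ q ∣ ℕ.≤ N
  ∣q∣≤N = N-largest ∣ q ∣ (2∣[i-1]⇒OddℕP∣i∣ {q} 2∣q-1) (begin
    3 ℕ.* ∣ q ∣    ≡⟨ ℕ.*-comm 3 ∣ q ∣ ⟩
    ∣ q ∣ ℕ.* 3    ≡⟨ abs-* q (+ 3) ⟨
    ∣ q * + 3 ∣    ≡⟨ cong ∣_∣ turns≡q*3 ⟨
    ∣ turns L p ∣  ≤⟨ turns-bound L p walk ⟩
    L              ∎)
    where open ℕ.≤-Reasoning

-- The flux of a polymorphism

a+b≡c+d⇒a-c≡d-b : ∀ a b c d → a + b ≡ c + d → a - c ≡ d - b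
a+b≡c+d⇒a-c≡d-b a b c d a+b≡c+d = begin
  a - c          ≡⟨ add-sub a b c ⟩
  a + b - b - c  ≡⟨ cong (λ x → x - b - c) a+b≡c+d ⟩
  c + d - b - c  ≡⟨ cancel c d b ⟩
  d - b          ∎
  where
  open ≡-Reasoning
  add-sub : ∀ a b c → a - c ≡ a + b - b - c
  add-sub = solve-∀
  cancel : ∀ c d b → c + d - b - c ≡ d - b
  cancel = solve-∀

i≡-i⇒i≡0 : ∀ {i} → i ≡ - i → i ≡ + 0
i≡-i⇒i≡0 {+ zero}    _  = refl
i≡-i⇒i≡0 {+[1+ n ]}  ()
i≡-i⇒i≡0 { -[1+ n ]} ()

sgn : Bool → ℤ
sgn true  = + 1
sgn false = - + 1

sgn-not-* : ∀ b x → sgn (not b) * x ≡ - (sgn b * x)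
sgn-not-* true  x = trans (-1*i≡-i x) (cong -_ (sym (*-identityˡ x)))
sgn-not-* false x = trans (*-identityˡ x) (trans (sym (neg-involutive x)) (cong -_ (sym (-1*i≡-i x))))

module Flux {K : ℕ} .{{_ : ℕ.NonZero K}} (3≤K : 3 ≤ K) {n : ℕ}
            (f : Vec (Fin K) n → Fin 3) (f-poly : IsPolymorphism n K f) where

  open Cycle K

  f-edge : ∀ a s → T (adjC 3 (f a) (f (a ⊕ s)))
  f-edge a s = f-poly a (a ⊕ s) (adjPow-⊕ a s)

  flux : Vec Bool n → ℤ
  flux s = ∑[ a ∈ tuples n K ] turn (f a) (f (a ⊕ s))

  flux-exchange : ∀ s r j → lookup s j ≡ lookup r j → flux s + flux (toggle j r) ≡ flux (toggle j s) + flux r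
  flux-exchange s r j sⱼ≡rⱼ = begin
    flux s + flux (toggle j r)
      ≡⟨ cong (_+_ (flux s)) (∑-⊕ n s _) ⟨
    flux s + ∑[ a ∈ V ] turn (f (a ⊕ s)) (f (a ⊕ s ⊕ toggle j r))
      ≡⟨ ∑-distrib-+ V _ _ ⟨
    ∑[ a ∈ V ] (turn (f a) (f (a ⊕ s)) + turn (f (a ⊕ s)) (f (a ⊕ s ⊕ toggle j r)))
      ≡⟨ ∑-cong V square ⟩
    ∑[ a ∈ V ] (turn (f a) (f (a ⊕ toggle j s)) + turn (f (a ⊕ toggle j s)) (f (a ⊕ toggle j s ⊕ r)))
      ≡⟨ ∑-distrib-+ V _ _ ⟩
    flux (toggle j s) + ∑[ a ∈ V ] turn (f (a ⊕ toggle j s)) (f (a ⊕ toggle j s ⊕ r))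
      ≡⟨ cong (_+_ (flux (toggle j s))) (∑-⊕ n (toggle j s) _) ⟩
    flux (toggle j s) + flux r
      ∎
    where
    open ≡-Reasoning
    V : List (Vec (Fin K) n)
    V = tuples n K
    square : ∀ a → turn (f a) (f (a ⊕ s)) + turn (f (a ⊕ s)) (f (a ⊕ s ⊕ toggle j r))
                 ≡ turn (f a) (f (a ⊕ toggle j s)) + turn (f (a ⊕ toggle j s)) (f (a ⊕ toggle j s ⊕ r))
    square a = trans (cong (λ z → turn (f a) (f (a ⊕ s)) + turn (f (a ⊕ s)) (f z)) exchange)
      (turn-square (f a) (f (a ⊕ s)) (f (a ⊕ toggle j s ⊕ r)) (f (a ⊕ toggle j s))
        (f-edge a s) (subst (T ∘ adjC 3 (f (a ⊕ s)) ∘ f) exchange (f-edge (a ⊕ s) (toggle j r)))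
        (f-edge a (toggle j s)) (f-edge (a ⊕ toggle j s) r))
      where
      exchange : a ⊕ s ⊕ toggle j r ≡ a ⊕ toggle j s ⊕ r
      exchange = ⊕-toggle-exchange a s r j sⱼ≡rⱼ

  flux-negate : ∀ s → flux (map not s) ≡ - flux s
  flux-negate s = begin
    flux (map not s)
      ≡⟨ ∑-⊕ n s _ ⟨
    ∑[ a ∈ V ] turn (f (a ⊕ s)) (f (a ⊕ s ⊕ map not s))
      ≡⟨ ∑-cong V (λ a → cong (turn (f (a ⊕ s)) ∘ f) (⊕-negate a s)) ⟩
    ∑[ a ∈ V ] turn (f (a ⊕ s)) (f a)
      ≡⟨ ∑-cong V (λ a → turn-antisym (f a) (f (a ⊕ s))) ⟩
    ∑[ a ∈ V ] (- turn (f a) (f (a ⊕ s)))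
      ≡⟨ ∑-neg V _ ⟩
    - flux s
      ∎
    where
    open ≡-Reasoning
    V : List (Vec (Fin K) n)
    V = tuples n K

  -- Δ i turns out to be 6 K^(n−1) deg_i f.
  Δ : Fin n → ℤ
  Δ i = flux (replicate n true) - flux (toggle i (replicate n true))

  flux-toggle : ∀ s i → flux s - flux (toggle i s) ≡ sgn (lookup s i) * Δ i
  flux-toggle s i with lookup s i in sᵢ≡b
  ... | true  = trans (a+b≡c+d⇒a-c≡d-b (flux s) (flux (toggle i 1ⁿ)) (flux (toggle i s)) (flux 1ⁿ)
                        (flux-exchange s 1ⁿ i (trans sᵢ≡b (sym (lookup-replicate i true)))))
                      (sym (*-identityˡ (Δ i)))
    where
    1ⁿ : Vec Bool n
    1ⁿ = replicate n true
  ... | false = begin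
    flux s - flux (toggle i s)
      ≡⟨ swap-difference (flux s) (flux (toggle i s)) ⟩
    - (flux (toggle i s) - flux s)
      ≡⟨ cong -_ (a+b≡c+d⇒a-c≡d-b (flux (toggle i s)) (flux (toggle i 1ⁿ)) (flux s) (flux 1ⁿ) exchange) ⟩
    - Δ i
      ≡⟨ -1*i≡-i (Δ i) ⟨
    - + 1 * Δ i
      ∎
    where
    open ≡-Reasoning
    1ⁿ : Vec Bool n
    1ⁿ = replicate n true
    exchange : flux (toggle i s) + flux (toggle i 1ⁿ) ≡ flux s + flux 1ⁿ
    exchange = trans (flux-exchange (toggle i s) 1ⁿ i
                       (trans (lookup-toggle i s) (trans (cong not sᵢ≡b) (sym (lookup-replicate i true)))))
                     (cong (λ r → flux r + flux 1ⁿ) (toggle-toggle i s))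
    swap-difference : ∀ a b → a - b ≡ - (b - a)
    swap-difference = solve-∀

  ∑sgnΔ : Vec Bool n → ℤ
  ∑sgnΔ s = ∑[ i ∈ allFinL n ] (sgn (lookup s i) * Δ i)

  -- Invariant under toggles and odd under negation, hence identically zero (flux-linear).
  defect : Vec Bool n → ℤ
  defect s = + 2 * flux s - ∑sgnΔ s

  defect-toggle : ∀ i s → defect (toggle i s) ≡ defect s
  defect-toggle i s = balance (flux s) (flux (toggle i s)) (sgn (lookup s i) * Δ i) (∑sgnΔ s) (∑sgnΔ (toggle i s))
    (flux-toggle s i)
    (begin
      ∑sgnΔ (toggle i s)
        ≡⟨ ∑-update n _ _ i (λ j j≢i → cong (λ b → sgn b * Δ j) (lookup-toggle-other i j s j≢i)) ⟩
      ∑sgnΔ s + (sgn (lookup (toggle i s) i) * Δ i - sgn (lookup s i) * Δ i)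
        ≡⟨ cong (λ b → ∑sgnΔ s + (sgn b * Δ i - sgn (lookup s i) * Δ i)) (lookup-toggle i s) ⟩
      ∑sgnΔ s + (sgn (not (lookup s i)) * Δ i - sgn (lookup s i) * Δ i)
        ≡⟨ cong (λ y → ∑sgnΔ s + (y - sgn (lookup s i) * Δ i)) (sgn-not-* (lookup s i) (Δ i)) ⟩
      ∑sgnΔ s + (- (sgn (lookup s i) * Δ i) - sgn (lookup s i) * Δ i)
        ∎)
    where
    open ≡-Reasoning
    balance : ∀ F F′ x S S′ → F - F′ ≡ x → S′ ≡ S + (- x - x) → + 2 * F′ - S′ ≡ + 2 * F - S
    balance F F′ x S S′ F-F′≡x S′≡S-2x = begin
      + 2 * F′ - S′
        ≡⟨ cong₂ (λ u v → + 2 * u - v) (trans (subtract F F′) (cong (_-_ F) F-F′≡x)) S′≡S-2x ⟩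
      + 2 * (F - x) - (S + (- x - x))
        ≡⟨ cancel F x S ⟩
      + 2 * F - S
        ∎
      where
      subtract : ∀ F F′ → F′ ≡ F - (F - F′)
      subtract = solve-∀
      cancel : ∀ F x S → + 2 * (F - x) - (S + (- x - x)) ≡ + 2 * F - S
      cancel = solve-∀

  defect-negate : ∀ s → defect (map not s) ≡ - defect s
  defect-negate s = begin
    + 2 * flux (map not s) - ∑sgnΔ (map not s)
      ≡⟨ cong₂ (λ u v → + 2 * u - v) (flux-negate s) ∑sgnΔ-negate ⟩
    + 2 * (- flux s) - (- ∑sgnΔ s)
      ≡⟨ negate (flux s) (∑sgnΔ s) ⟩
    - defect s
      ∎
    where
    open ≡-Reasoning
    ∑sgnΔ-negate : ∑sgnΔ (map not s) ≡ - ∑sgnΔ s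
    ∑sgnΔ-negate = trans (∑-cong (allFinL n) (λ i → trans (cong (λ b → sgn b * Δ i) (lookup-map i not s))
                                                        (sgn-not-* (lookup s i) (Δ i))))
                         (∑-neg (allFinL n) _)
    negate : ∀ F S → + 2 * (- F) - (- S) ≡ - (+ 2 * F - S)
    negate = solve-∀

  flux-linear : ∀ s → + 2 * flux s ≡ ∑sgnΔ s
  flux-linear s = i-j≡0⇒i≡j (+ 2 * flux s) (∑sgnΔ s)
    (i≡-i⇒i≡0 (trans (toggle-invariant⇒constant defect defect-toggle s (map not s)) (defect-negate s)))

  ∑-flux : ∑ (signs n) flux ≡ + 0
  ∑-flux = i≡-i⇒i≡0
    (trans (sym (∑-negate n flux)) (trans (∑-cong (signs n) flux-negate) (∑-neg (signs n) flux)))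

  flux⁺ : Fin n → ℤ
  flux⁺ i = ∑[ s ∈ signs n ] (if lookup s i then flux s else + 0)

  -- Pairing s with toggle i s: flux⁺ i + flux⁻ = ∑ flux = 0, while flux⁺ i − flux⁻ = count · Δ i
  -- with count = 2ⁿ⁻¹.
  4flux⁺≡2ⁿΔ : ∀ i → + 4 * flux⁺ i ≡ + (2 ℕ.^ n) * Δ i
  4flux⁺≡2ⁿΔ i = begin
    + 4 * flux⁺ i
      ≡⟨ halves (flux⁺ i) flux⁻ ⟩
    + 2 * (flux⁺ i + flux⁻) + + 2 * (flux⁺ i - flux⁻)
      ≡⟨ cong₂ (λ u v → + 2 * u + + 2 * v) sum≡0 difference ⟩
    + 2 * + 0 + + 2 * (Δ i * count)
      ≡⟨ collect (Δ i) count ⟩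
    (count + count) * Δ i
      ≡⟨ cong (_* Δ i) count+count ⟩
    + (2 ℕ.^ n) * Δ i
      ∎
    where
    open ≡-Reasoning
    flux⁻ count : ℤ
    flux⁻ = ∑[ s ∈ signs n ] (if lookup s i then flux (toggle i s) else + 0)
    count = ∑[ s ∈ signs n ] (if lookup s i then + 1 else + 0)
    halves : ∀ p q → + 4 * p ≡ + 2 * (p + q) + + 2 * (p - q)
    halves = solve-∀
    collect : ∀ d c → + 2 * + 0 + + 2 * (d * c) ≡ (c + c) * d
    collect = solve-∀
    sum≡0 : flux⁺ i + flux⁻ ≡ + 0
    sum≡0 = trans (sym (∑-split n i flux)) ∑-flux
    count+count : count + count ≡ + (2 ℕ.^ n)
    count+count = begin
      count + count             ≡⟨ ∑-split n i (λ _ → + 1) ⟨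
      ∑[ s ∈ signs n ] + 1      ≡⟨ ∑-const (signs n) (+ 1) ⟩
      + length (signs n) * + 1  ≡⟨ *-identityʳ _ ⟩
      + length (signs n)        ≡⟨ cong +_ (length-signs n) ⟩
      + (2 ℕ.^ n)               ∎
    difference : flux⁺ i - flux⁻ ≡ Δ i * count
    difference = begin
      flux⁺ i - flux⁻
        ≡⟨ cong (_+_ (flux⁺ i)) (∑-neg (signs n) _) ⟨
      flux⁺ i + ∑[ s ∈ signs n ] (- (if lookup s i then flux (toggle i s) else + 0))
        ≡⟨ ∑-distrib-+ (signs n) _ _ ⟨
      ∑[ s ∈ signs n ] ((if lookup s i then flux s else + 0) - (if lookup s i then flux (toggle i s) else + 0))
        ≡⟨ ∑-cong (signs n) pointwise ⟩
      ∑[ s ∈ signs n ] (Δ i * (if lookup s i then + 1 else + 0))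
        ≡⟨ ∑-distribˡ-* (signs n) (Δ i) _ ⟩
      Δ i * count
        ∎
      where
      pointwise : ∀ s → (if lookup s i then flux s else + 0) - (if lookup s i then flux (toggle i s) else + 0)
                        ≡ Δ i * (if lookup s i then + 1 else + 0)
      pointwise s with lookup s i in sᵢ≡b
      ... | true  = trans (flux-toggle s i) (trans (cong (λ b → sgn b * Δ i) sᵢ≡b)
                                                   (trans (*-identityˡ (Δ i)) (sym (*-identityʳ (Δ i)))))
      ... | false = sym (*-zeroʳ (Δ i))

  inO-turns : ∀ i → ∑[ a ∈ tuples n K ] ∑[ b ∈ tuples n K ] (if inO n K i a b then turn (f a) (f b) else + 0)
                    ≡ flux⁺ i
  inO-turns i = begin
    ∑[ a ∈ V ] ∑[ b ∈ V ] (if adjPow n K a b ∧ next K (lookup a i) (lookup b i) then turn (f a) (f b) else + 0)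
      ≡⟨ ∑-cong V (λ a → ∑-cong V (λ b → if-∧ (adjPow n K a b) _)) ⟩
    ∑[ a ∈ V ] ∑[ b ∈ V ]
      (if adjPow n K a b then (if next K (lookup a i) (lookup b i) then turn (f a) (f b) else + 0) else + 0)
      ≡⟨ ∑-cong V (λ a → ∑-adjPow 3≤K n a _) ⟩
    ∑[ a ∈ V ] ∑[ s ∈ signs n ] (if next K (lookup a i) (lookup (a ⊕ s) i) then turn (f a) (f (a ⊕ s)) else + 0)
      ≡⟨ ∑-cong V (λ a → ∑-cong (signs n) λ s →
           cong (if_then turn (f a) (f (a ⊕ s)) else + 0) (next-lookup a s)) ⟩
    ∑[ a ∈ V ] ∑[ s ∈ signs n ] (if lookup s i then turn (f a) (f (a ⊕ s)) else + 0)
      ≡⟨ ∑-comm V (signs n) _ ⟩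
    ∑[ s ∈ signs n ] ∑[ a ∈ V ] (if lookup s i then turn (f a) (f (a ⊕ s)) else + 0)
      ≡⟨ ∑-cong (signs n) (λ s → ∑-if V (lookup s i) _) ⟩
    flux⁺ i
      ∎
    where
    open ≡-Reasoning
    V : List (Vec (Fin K) n)
    V = tuples n K
    next-lookup : ∀ a s → next K (lookup a i) (lookup (a ⊕ s) i) ≡ lookup s i
    next-lookup a s = trans (cong (next K (lookup a i)) (lookup-⊕ a s i)) (next-step 3≤K (lookup s i) (lookup a i))

  walk : Vec Bool n → Vec (Fin K) n → ℕ → Fin 3
  walk s a t = f (iterate (_⊕ s) a t)

  walk-IsWalk : ∀ s a → IsWalk (walk s a)
  walk-IsWalk s a t = subst (T ∘ adjC 3 (walk s a t) ∘ f) (sym (iterate-suc t)) (f-edge (iterate (_⊕ s) a t) s)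
    where
    iterate-suc : ∀ t → iterate (_⊕ s) a (suc t) ≡ iterate (_⊕ s) a t ⊕ s
    iterate-suc t = trans (sym (iterate-is-fold a (_⊕ s) (suc t))) (cong (_⊕ s) (iterate-is-fold a (_⊕ s) t))

  walk-closed : ∀ s a → walk s a K ≡ walk s a 0
  walk-closed s a = cong f (iterate-⊕-K s a)

  ∑-turns : ∀ L s → ∑[ a ∈ tuples n K ] turns L (walk s a) ≡ + L * flux s
  ∑-turns zero    s = ∑-zero (tuples n K)
  ∑-turns (suc L) s = begin
    ∑[ a ∈ V ] (turn (f a) (f (a ⊕ s)) + turns L (walk s (a ⊕ s)))  ≡⟨ ∑-distrib-+ V _ _ ⟩
    flux s + ∑[ a ∈ V ] turns L (walk s (a ⊕ s))                     ≡⟨ cong (_+_ (flux s)) (∑-⊕ n s _) ⟩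
    flux s + ∑[ a ∈ V ] turns L (walk s a)                           ≡⟨ cong (_+_ (flux s)) (∑-turns L s) ⟩
    flux s + + L * flux s                                            ≡⟨ regroup (+ L) (flux s) ⟩
    + suc L * flux s                                                 ∎
    where
    open ≡-Reasoning
    V : List (Vec (Fin K) n)
    V = tuples n K
    regroup : ∀ l x → x + l * x ≡ (+ 1 + l) * x
    regroup = solve-∀

-- Degrees

fE-O-turns : ∀ n k (f : Vec (Fin k) n → Fin 3) i →
  fE-O n k f i zero + fE-O n k f i (suc zero) + fE-O n k f i (suc (suc zero))
    ≡ ∑[ a ∈ tuples n k ] ∑[ b ∈ tuples n k ] (if inO n k i a b then turn (f a) (f b) else + 0)
fE-O-turns n k f i = begin
  fE-O n k f i zero + fE-O n k f i (suc zero) + fE-O n k f i (suc (suc zero))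
    ≡⟨ cong₂ _+_ (cong₂ _+_ (as-∑ zero) (as-∑ (suc zero))) (as-∑ (suc (suc zero))) ⟩
  ∑[ a ∈ V ] ∑[ b ∈ V ] E a b zero + ∑[ a ∈ V ] ∑[ b ∈ V ] E a b (suc zero)
    + ∑[ a ∈ V ] ∑[ b ∈ V ] E a b (suc (suc zero))
    ≡⟨ ∑-distrib-+₃ V _ _ _ ⟩
  ∑[ a ∈ V ] (∑[ b ∈ V ] E a b zero + ∑[ b ∈ V ] E a b (suc zero) + ∑[ b ∈ V ] E a b (suc (suc zero)))
    ≡⟨ ∑-cong V (λ a → trans (∑-distrib-+₃ V _ _ _) (∑-cong V (λ b → if-sum (inO n k i a b)))) ⟩
  ∑[ a ∈ V ] ∑[ b ∈ V ] (if inO n k i a b then turn (f a) (f b) else + 0)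
    ∎
  where
  open ≡-Reasoning
  V : List (Vec (Fin k) n)
  V = tuples n k
  E : Vec (Fin k) n → Vec (Fin k) n → Fin 3 → ℤ
  E a b j = if inO n k i a b then edgeCoeff (f a) (f b) j else + 0
  as-∑ : ∀ j → fE-O n k f i j ≡ ∑[ a ∈ V ] ∑[ b ∈ V ] E a b j
  as-∑ j = sumℤL-concatMap (λ a → List.map (λ b → E a b j) V) V
  if-sum : ∀ c {x y z : ℤ} → (if c then x else + 0) + (if c then y else + 0) + (if c then z else + 0)
                           ≡ (if c then x + y + z else + 0)
  if-sum true  = refl
  if-sum false = refl

^-distribʳ-* : ∀ a b t → (a ℕ.* b) ℕ.^ t ≡ a ℕ.^ t ℕ.* b ℕ.^ t
^-distribʳ-* a b zero    = refl
^-distribʳ-* a b (suc t) = trans (cong (a ℕ.* b ℕ.*_) (^-distribʳ-* a b t)) (interchange a b (a ℕ.^ t) (b ℕ.^ t))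
  where
  interchange : ∀ a b x y → a ℕ.* b ℕ.* (x ℕ.* y) ≡ a ℕ.* x ℕ.* (b ℕ.* y)
  interchange = ℕ-Solver.solve-∀

isNonNeg : ℤ → Bool
isNonNeg (+ _)    = true
isNonNeg -[1+ _ ] = false

sgn-isNonNeg : ∀ d → sgn (isNonNeg d) * d ≡ + ∣ d ∣
sgn-isNonNeg (+ n)    = *-identityˡ (+ n)
sgn-isNonNeg -[1+ n ] = -1*i≡-i -[1+ n ]

module DegreeBound {K N : ℕ} .{{_ : ℕ.NonZero K}} (3≤K : 3 ≤ K) (K-odd : OddℕP K)
                   (N-largest : IsLargestOddBelowThird K N) {m : ℕ}
                   (f : Vec (Fin K) (suc m) → Fin 3) (f-poly : IsPolymorphism (suc m) K f)
                   (deg : Fin (suc m) → ℤ) (deg-spec : ∀ i → IsDeg (suc m) K f i (deg i)) where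

  open Cycle K using (length-tuples)
  open Flux 3≤K f f-poly

  Δ≡6Kᵐdeg : ∀ i → Δ i ≡ + 6 * + (K ℕ.^ m) * deg i
  Δ≡6Kᵐdeg i = *-cancelˡ-≡ (+ (2 ℕ.^ suc m)) (Δ i) _ {{ℕ.m^n≢0 2 (suc m)}} (begin
    + (2 ℕ.^ suc m) * Δ i
      ≡⟨ 4flux⁺≡2ⁿΔ i ⟨
    + 4 * flux⁺ i
      ≡⟨ cong (+ 4 *_) (trans (sym (inO-turns i)) (sym (fE-O-turns (suc m) K f i))) ⟩
    + 4 * (fE-O (suc m) K f i zero + fE-O (suc m) K f i (suc zero) + fE-O (suc m) K f i (suc (suc zero)))
      ≡⟨ cong (+ 4 *_) (cong₂ _+_ (cong₂ _+_ (deg-spec i zero) (deg-spec i (suc zero)))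
                                   (deg-spec i (suc (suc zero)))) ⟩
    + 4 * (c * deg i * + 1 + c * deg i * + 1 + c * deg i * + 1)
      ≡⟨ cong (λ x → + 4 * (x * deg i * + 1 + x * deg i * + 1 + x * deg i * + 1)) c≡2ᵐKᵐ ⟩
    + 4 * (u * v * deg i * + 1 + u * v * deg i * + 1 + u * v * deg i * + 1)
      ≡⟨ twelve u v (deg i) ⟩
    + 2 * u * (+ 6 * v * deg i)
      ≡⟨ cong (_* (+ 6 * v * deg i)) (pos-* 2 (2 ℕ.^ m)) ⟨
    + (2 ℕ.^ suc m) * (+ 6 * v * deg i)
      ∎)
    where
    open ≡-Reasoning
    c u v : ℤ
    c = + ((2 ℕ.* K) ℕ.^ m)
    u = + (2 ℕ.^ m)
    v = + (K ℕ.^ m)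
    c≡2ᵐKᵐ : c ≡ u * v
    c≡2ᵐKᵐ = trans (cong +_ (^-distribʳ-* 2 K m)) (pos-* (2 ℕ.^ m) (K ℕ.^ m))
    twelve : ∀ u v d → + 4 * (u * v * d * + 1 + u * v * d * + 1 + u * v * d * + 1) ≡ + 2 * u * (+ 6 * v * d)
    twelve = solve-∀

  ε : Vec Bool (suc m)
  ε = tabulate (isNonNeg ∘ deg)

  S : ℕ
  S = sumℕ (suc m) (∣_∣ ∘ deg)

  flux-ε : flux ε ≡ + 3 * + (K ℕ.^ m) * + S
  flux-ε = *-cancelˡ-≡ (+ 2) _ _ (begin
    + 2 * flux ε
      ≡⟨ flux-linear ε ⟩
    ∑[ i ∈ allFinL (suc m) ] (sgn (lookup ε i) * Δ i)
      ≡⟨ ∑-cong (allFinL (suc m)) pointwise ⟩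
    ∑[ i ∈ allFinL (suc m) ] (+ 6 * + (K ℕ.^ m) * + ∣ deg i ∣)
      ≡⟨ ∑-distribˡ-* (allFinL (suc m)) (+ 6 * + (K ℕ.^ m)) _ ⟩
    + 6 * + (K ℕ.^ m) * (∑[ i ∈ allFinL (suc m) ] + ∣ deg i ∣)
      ≡⟨ cong (+ 6 * + (K ℕ.^ m) *_) (∑-pos (suc m) (∣_∣ ∘ deg)) ⟩
    + 6 * + (K ℕ.^ m) * + S
      ≡⟨ halve (+ (K ℕ.^ m)) (+ S) ⟩
    + 2 * (+ 3 * + (K ℕ.^ m) * + S)
      ∎)
    where
    open ≡-Reasoning
    pointwise : ∀ i → sgn (lookup ε i) * Δ i ≡ + 6 * + (K ℕ.^ m) * + ∣ deg i ∣
    pointwise i = begin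
      sgn (lookup ε i) * Δ i
        ≡⟨ cong₂ (λ b x → sgn b * x) (lookup∘tabulate (isNonNeg ∘ deg) i) (Δ≡6Kᵐdeg i) ⟩
      sgn (isNonNeg (deg i)) * (+ 6 * + (K ℕ.^ m) * deg i)
        ≡⟨ reassociate (sgn (isNonNeg (deg i))) (+ (K ℕ.^ m)) (deg i) ⟩
      + 6 * + (K ℕ.^ m) * (sgn (isNonNeg (deg i)) * deg i)
        ≡⟨ cong (+ 6 * + (K ℕ.^ m) *_) (sgn-isNonNeg (deg i)) ⟩
      + 6 * + (K ℕ.^ m) * + ∣ deg i ∣
        ∎
      where
      reassociate : ∀ s v d → s * (+ 6 * v * d) ≡ + 6 * v * (s * d)
      reassociate = solve-∀
    halve : ∀ v s → + 6 * v * s ≡ + 2 * (+ 3 * v * s)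
    halve = solve-∀

  closed-walks : ∀ a → ∃ λ q → turns K (walk ε a) ≡ q * + 3 × + 2 ∣ q - + 1 × ∣ q ∣ ℕ.≤ N
  closed-walks a = closed-walk (walk ε a) (walk-IsWalk ε a) (walk-closed ε a) K-odd N-largest

  winding : Vec (Fin K) (suc m) → ℤ
  winding a = proj₁ (closed-walks a)

  Kᵐ⁺¹S≡∑winding : + length (tuples (suc m) K) * + S ≡ ∑ (tuples (suc m) K) winding
  Kᵐ⁺¹S≡∑winding = *-cancelʳ-≡ _ _ (+ 3) (begin
    + length V * + S * + 3           ≡⟨ cong (λ l → + l * + S * + 3) (length-tuples (suc m)) ⟩
    + (K ℕ.^ suc m) * + S * + 3      ≡⟨ cong (λ x → x * + S * + 3) (pos-* K (K ℕ.^ m)) ⟩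
    + K * + (K ℕ.^ m) * + S * + 3    ≡⟨ regroup (+ K) (+ (K ℕ.^ m)) (+ S) ⟩
    + K * (+ 3 * + (K ℕ.^ m) * + S)  ≡⟨ cong (+ K *_) flux-ε ⟨
    + K * flux ε                     ≡⟨ ∑-turns K ε ⟨
    ∑[ a ∈ V ] turns K (walk ε a)    ≡⟨ ∑-cong V (proj₁ ∘ proj₂ ∘ closed-walks) ⟩
    ∑[ a ∈ V ] (winding a * + 3)     ≡⟨ ∑-distribʳ-* V (+ 3) winding ⟩
    ∑ V winding * + 3                ∎)
    where
    open ≡-Reasoning
    V : List (Vec (Fin K) (suc m))
    V = tuples (suc m) K
    regroup : ∀ k v s → k * v * s * + 3 ≡ k * (+ 3 * v * s)
    regroup = solve-∀

  S≤N×S-odd : S ℕ.≤ N × + 2 ∣ + S - + 1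
  S≤N×S-odd = odd-average (tuples (suc m) K) winding
    (proj₁ ∘ proj₂ ∘ proj₂ ∘ closed-walks) (proj₂ ∘ proj₂ ∘ proj₂ ∘ closed-walks)
    (subst (λ l → + 2 ∣ + l - + 1) (sym (length-tuples (suc m)))
           (∣[m-1]⇒∣[m^t-1] K (suc m) (OddℕP⇒2∣[n-1] K-odd)))
    Kᵐ⁺¹S≡∑winding

lemma5p12 : (k N : ℕ) → OddℕP k → 3 ≤ k → IsLargestOddBelowThird k N →
    (n : ℕ) → 1 ≤ n → (f : Vec (Fin k) n → Fin 3) → IsPolymorphism n k f →
    (deg : Fin n → ℤ) → (∀ i → IsDeg n k f i (deg i)) →
    InZ≤ N n deg
lemma5p12 k N k-odd 3≤k N-largest (suc m) _ f f-poly deg deg-spec =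
  proj₁ S≤N×S-odd , odd-∑∣∣⇒odd-sumℤ (suc m) deg (proj₂ S≤N×S-odd)
  where
  instance
    k-nonZero : ℕ.NonZero k
    k-nonZero = ℕ.>-nonZero (ℕ.≤-trans (s≤s z≤n) 3≤k)
  open DegreeBound 3≤k k-odd N-largest f f-poly deg deg-spec
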